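{- Let $r\geq 1$ and $n\geq 2$ be integers, and let $C_n$ be the cycle on $n$ vertices (for $n=2$, $C_2$ is a single edge on two vertices). Then for any cross-intersecting pair $(\mathcal{A},\mathcal{B})$ in $\mathcal{J}^r(C_n)$, we have $|\mathcal{A}|+|\mathcal{B}|\leq |\mathcal{J}^r(C_n)|$.
   Context: For a graph $G$, $\mathcal{J}^r(G)$ denotes the family of all independent vertex sets of size $r$ in $G$. A pair $(\mathcal{A},\mathcal{B})$ is a cross-intersecting pair in $\mathcal{J}^r(G)$ if $\mathcal{A},\mathcal{B}\subseteq\mathcal{J}^r(G)$ and $A\cap B\neq\emptyset$ for every $A\in\mathcal{A}$, $B\in\mathcal{B}$ (the families need not be non-empty or intersecting themselves). -}

module Defs where

open import Data.Nat using (ℕ; zero; suc; _≟_)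
open import Data.Fin using (Fin; toℕ)
open import Data.Fin.Subset using (Subset; _∈_; ∣_∣)
open import Data.List using (List)
open import Data.List.Membership.Propositional using () renaming (_∈_ to _∈ₗ_)
open import Data.List.Relation.Unary.Unique.Propositional using (Unique)
open import Data.List.Relation.Unary.All using (All)
open import Data.Product using (_×_; ∃)
open import Data.Sum using (_⊎_)
open import Data.Empty using (⊥)
open import Function.Bundles using (_⇔_)
open import Relation.Binary.PropositionalEquality using (_≡_)
open import Relation.Nullary using (¬_; yes; no)

succMod : ℕ → ℕ → ℕ
succMod n i with suc i ≟ n
... | yes _ = 0
... | no _  = suc i

-- Adjacency in the cycle C_n on vertex set Fin n = {0,…,n-1}:
-- i ~ j iff j ≡ i + 1 (mod n) or i ≡ j + 1 (mod n).
-- For n = 2 this is the single edge {0,1}.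
CycleAdj : (n : ℕ) → Fin n → Fin n → Set
CycleAdj n i j = (toℕ j ≡ succMod n (toℕ i)) ⊎ (toℕ i ≡ succMod n (toℕ j))

IndependentC : (n : ℕ) → Subset n → Set
IndependentC n S = ∀ (i j : Fin n) → i ∈ S → j ∈ S → ¬ CycleAdj n i j

InJ : (n r : ℕ) → Subset n → Set
InJ n r S = IndependentC n S × (∣ S ∣ ≡ r)

-- A (finite) family of vertex sets, given as a duplicate-free list.
-- 𝓐 ⊆ 𝒥^r(C_n):
FamilyInJ : (n r : ℕ) → List (Subset n) → Set
FamilyInJ n r 𝓐 = Unique 𝓐 × All (InJ n r) 𝓐

-- A duplicate-free list enumerating exactly 𝒥^r(C_n);
-- its length is |𝒥^r(C_n)|.
EnumeratesJ : (n r : ℕ) → List (Subset n) → Set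
EnumeratesJ n r L = Unique L × (∀ S → (S ∈ₗ L) ⇔ InJ n r S)

CrossIntersecting : (n : ℕ) → List (Subset n) → List (Subset n) → Set
CrossIntersecting n 𝓐 𝓑 =
  ∀ A B → A ∈ₗ 𝓐 → B ∈ₗ 𝓑 → ∃ λ (v : Fin n) → (v ∈ A) × (v ∈ B)

module Submission where

-- Let ρ be the rotation of C_n that
-- moves every vertex one step back: i ∈ ρ S iff i + 1 (mod n) ∈ S.
--   * ρ is an automorphism of C_n, so it maps 𝒥^r(C_n) into itself, and it
--     is injective on vertex sets.
--   * If S is independent then S ∩ ρ S = ∅: a common vertex i would put both
--     i and its neighbour i + 1 into S.
--   * Hence ρ(𝓐) and 𝓑 are disjoint: ρ A ∈ 𝓑 would force A ∩ ρ A ≠ ∅.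
-- So the list ρ(𝓐) ++ 𝓑 is duplicate-free, has length |𝓐| + |𝓑|, and all its
-- members lie in 𝒥^r(C_n); a pigeonhole principle for duplicate-free lists
-- bounds its length by |𝒥^r(C_n)|.  The hypotheses r ≥ 1 and n ≥ 2 are only
-- needed through n ≥ 1 (so that the rotation is defined).

open import Defs
open import Data.Nat using (ℕ; suc; _+_; _≤_; _<_; _≟_; z≤n; s≤s)
open import Data.Nat.Properties using (≤-trans; suc-injective; ≤∧≢⇒<; module ≤-Reasoning)
open import Data.Bool using (true; false)
open import Data.Fin using (Fin; toℕ; fromℕ<)
open import Data.Fin.Properties using (toℕ-fromℕ<; toℕ<n)
open import Data.Fin.Subset using (Subset; _∈_)
open import Data.Vec using (Vec; []; _∷_; _∷ʳ_; lookup; count)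
open import Data.Vec.Properties using ([]=⇒lookup; lookup⇒[]=; ∷ʳ-injective)
open import Data.List using (List; []; _∷_; length; map; _++_)
open import Data.List.Properties using (length-++; length-map; length-removeAt′)
open import Data.List.Membership.Propositional using (_─_) renaming (_∈_ to _∈ₗ_)
open import Data.List.Membership.Propositional.Properties using (∈-map⁻)
open import Data.List.Relation.Unary.Any using (here; there; index)
open import Data.List.Relation.Unary.AllPairs using ([]; _∷_)
open import Data.List.Relation.Unary.All using (All)
import Data.List.Relation.Unary.All as All
import Data.List.Relation.Unary.All.Properties as All
open import Data.List.Relation.Binary.Disjoint.Propositional using (Disjoint)
open import Data.List.Relation.Unary.Unique.Propositional using (Unique)
import Data.List.Relation.Unary.Unique.Propositional.Properties as Unique
open import Data.Product using (_,_; proj₁)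
open import Data.Sum using (inj₁)
import Data.Sum as Sum
open import Data.Empty using (⊥; ⊥-elim)
open import Function.Bundles using (Equivalence)
open import Relation.Binary.PropositionalEquality using (_≡_; _≢_; refl; sym; trans; cong; module ≡-Reasoning)
open import Relation.Nullary using (yes; no; does)
open import Relation.Unary using (Pred; Decidable)

module _ {a} {A : Set a} where

  ∈-─ : ∀ {x y} {xs : List A} (x∈xs : x ∈ₗ xs) → y ∈ₗ xs → x ≢ y → y ∈ₗ xs ─ x∈xs
  ∈-─ (here refl) (here refl) x≢y = ⊥-elim (x≢y refl)
  ∈-─ (here _)    (there y∈xs) _   = y∈xs
  ∈-─ (there _)   (here y≡z)  _    = here y≡z
  ∈-─ (there x∈xs) (there y∈xs) x≢y = there (∈-─ x∈xs y∈xs x≢y)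

  unique-⊆⇒length-≤ : ∀ {xs ys : List A} → Unique xs → (∀ {y} → y ∈ₗ xs → y ∈ₗ ys) →
                      length xs ≤ length ys
  unique-⊆⇒length-≤ {[]}      _            _   = z≤n
  unique-⊆⇒length-≤ {x ∷ xs} {ys} (x∉xs ∷ u) xs⊆ys = begin
    suc (length xs)          ≤⟨ s≤s (unique-⊆⇒length-≤ u xs⊆ys─x) ⟩
    suc (length (ys ─ x∈ys)) ≡⟨ sym (length-removeAt′ ys (index x∈ys)) ⟩
    length ys                ∎
    where
    open ≤-Reasoning
    x∈ys : x ∈ₗ ys
    x∈ys = xs⊆ys (here refl)
    xs⊆ys─x : ∀ {y} → y ∈ₗ xs → y ∈ₗ ys ─ x∈ys
    xs⊆ys─x y∈xs = ∈-─ x∈ys (xs⊆ys (there y∈xs)) (All.lookup x∉xs y∈xs)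

module _ {a} {A : Set a} where

  rotate : ∀ {m} → Vec A (suc m) → Vec A (suc m)
  rotate (x ∷ xs) = xs ∷ʳ x

  lookup-∷ʳ-init : ∀ {m} (xs : Vec A m) x (i : Fin (suc m)) (j : Fin m) →
                   toℕ i ≡ toℕ j → lookup (xs ∷ʳ x) i ≡ lookup xs j
  lookup-∷ʳ-init (y ∷ xs) x Fin.zero    Fin.zero    _     = refl
  lookup-∷ʳ-init (y ∷ xs) x (Fin.suc i) (Fin.suc j) 1+i≡1+j =
    lookup-∷ʳ-init xs x i j (suc-injective 1+i≡1+j)

  lookup-∷ʳ-last : ∀ {m} (xs : Vec A m) x (i : Fin (suc m)) →
                   toℕ i ≡ m → lookup (xs ∷ʳ x) i ≡ x
  lookup-∷ʳ-last []       x Fin.zero    _      = refl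
  lookup-∷ʳ-last (y ∷ xs) x (Fin.suc i) 1+i≡1+m = lookup-∷ʳ-last xs x i (suc-injective 1+i≡1+m)

  lookup-rotate : ∀ {m} (S : Vec A (suc m)) (i j : Fin (suc m)) →
                  toℕ j ≡ succMod (suc m) (toℕ i) → lookup (rotate S) i ≡ lookup S j
  lookup-rotate {m} (x ∷ xs) i Fin.zero j≡i+1 with suc (toℕ i) ≟ suc m
  ... | yes 1+i≡1+m = lookup-∷ʳ-last xs x i (suc-injective 1+i≡1+m)
  ... | no _        with () ← j≡i+1
  lookup-rotate {m} (x ∷ xs) i (Fin.suc j) j≡i+1 with suc (toℕ i) ≟ suc m
  ... | yes _ with () ← j≡i+1
  ... | no _  = lookup-∷ʳ-init xs x i j (sym (suc-injective j≡i+1))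

  rotate-injective : ∀ {m} {S T : Vec A (suc m)} → rotate S ≡ rotate T → S ≡ T
  rotate-injective {S = x ∷ xs} {T = y ∷ ys} eq with ∷ʳ-injective xs ys eq
  ... | refl , refl = refl

  module _ {p} {P : Pred A p} (P? : Decidable P) where

    count-∷ʳ : ∀ {m} (xs : Vec A m) x → count P? (xs ∷ʳ x) ≡ count P? (x ∷ xs)
    count-∷ʳ []       x = refl
    count-∷ʳ (y ∷ xs) x rewrite count-∷ʳ xs x with does (P? x) | does (P? y)
    ... | true  | true  = refl
    ... | true  | false = refl
    ... | false | true  = refl
    ... | false | false = refl

    count-rotate : ∀ {m} (S : Vec A (suc m)) → count P? (rotate S) ≡ count P? S
    count-rotate (x ∷ xs) = count-∷ʳ xs x

succMod-< : ∀ n k → k < n → succMod n k < n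
succMod-< n k k<n with suc k ≟ n
... | yes _     = ≤-trans (s≤s z≤n) k<n
... | no 1+k≢n  = ≤∧≢⇒< k<n 1+k≢n

next : ∀ {n} → Fin n → Fin n
next {n} i = fromℕ< (succMod-< n (toℕ i) (toℕ<n i))

toℕ-next : ∀ {n} (i : Fin n) → toℕ (next i) ≡ succMod n (toℕ i)
toℕ-next {n} i = toℕ-fromℕ< (succMod-< n (toℕ i) (toℕ<n i))

adjacent-next : ∀ {n} (i : Fin n) → CycleAdj n i (next i)
adjacent-next i = inj₁ (toℕ-next i)

next-successor : ∀ {n} {i j : Fin n} → toℕ j ≡ succMod n (toℕ i) →
                 toℕ (next j) ≡ succMod n (toℕ (next i))
next-successor {n} {i} {j} j≡i+1 = begin
  toℕ (next j)                  ≡⟨ toℕ-next j ⟩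
  succMod n (toℕ j)             ≡⟨ cong (succMod n) j≡i+1 ⟩
  succMod n (succMod n (toℕ i)) ≡⟨ cong (succMod n) (sym (toℕ-next i)) ⟩
  succMod n (toℕ (next i))      ∎
  where open ≡-Reasoning

next-adjacent : ∀ {n} {i j : Fin n} → CycleAdj n i j → CycleAdj n (next i) (next j)
next-adjacent = Sum.map next-successor next-successor

module _ {m : ℕ} where

  ∈-rotate⁻ : (S : Subset (suc m)) (i : Fin (suc m)) → i ∈ rotate S → next i ∈ S
  ∈-rotate⁻ S i i∈ρS = lookup⇒[]= (next i) S (begin
    lookup S (next i)  ≡⟨ sym (lookup-rotate S i (next i) (toℕ-next i)) ⟩
    lookup (rotate S) i ≡⟨ []=⇒lookup i∈ρS ⟩
    true               ∎)
    where open ≡-Reasoning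

  rotate-independent : (S : Subset (suc m)) → IndependentC (suc m) S →
                       IndependentC (suc m) (rotate S)
  rotate-independent S indep i j i∈ρS j∈ρS i~j =
    indep (next i) (next j) (∈-rotate⁻ S i i∈ρS) (∈-rotate⁻ S j j∈ρS) (next-adjacent i~j)

  rotate-InJ : ∀ {r} (S : Subset (suc m)) → InJ (suc m) r S → InJ (suc m) r (rotate S)
  rotate-InJ S (indep , ∣S∣≡r) = rotate-independent S indep , trans (count-rotate _ S) ∣S∣≡r

  independent-disjoint-rotate : (S : Subset (suc m)) → IndependentC (suc m) S →
                                ∀ i → i ∈ S → i ∈ rotate S → ⊥
  independent-disjoint-rotate S indep i i∈S i∈ρS =
    indep i (next i) i∈S (∈-rotate⁻ S i i∈ρS) (adjacent-next i)

  -- The key step: if (𝓐, 𝓑) is cross-intersecting and the members of 𝓐 are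
  -- independent, then no rotated member of 𝓐 belongs to 𝓑, since A and its
  -- rotation would have to intersect.
  rotated-disjoint : ∀ {𝓐 𝓑 : List (Subset (suc m))} → All (IndependentC (suc m)) 𝓐 →
                     CrossIntersecting (suc m) 𝓐 𝓑 → Disjoint (map rotate 𝓐) 𝓑
  rotated-disjoint 𝓐-indep cross (S∈ρ𝓐 , S∈𝓑) with ∈-map⁻ rotate S∈ρ𝓐
  ... | A , A∈𝓐 , refl with cross A (rotate A) A∈𝓐 S∈𝓑
  ...   | v , v∈A , v∈ρA = independent-disjoint-rotate A (All.lookup 𝓐-indep A∈𝓐) v v∈A v∈ρA

⊆-enumeration : ∀ {n r} {L J : List (Subset n)} → All (InJ n r) L → EnumeratesJ n r J →
                ∀ {S} → S ∈ₗ L → S ∈ₗ J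
⊆-enumeration L⊆𝒥 (_ , enum) {S} S∈L = Equivalence.from (enum S) (All.lookup L⊆𝒥 S∈L)

theorem1p9 : (r n : ℕ) → 1 ≤ r → 2 ≤ n → (𝓐 𝓑 J : List (Subset n)) → FamilyInJ n r 𝓐 → FamilyInJ n r 𝓑 → CrossIntersecting n 𝓐 𝓑 → EnumeratesJ n r J → length 𝓐 + length 𝓑 ≤ length J
theorem1p9 r (suc m) _ _ 𝓐 𝓑 J (𝓐-unique , 𝓐⊆𝒥) (𝓑-unique , 𝓑⊆𝒥) cross J-enum = begin
  length 𝓐 + length 𝓑   ≡⟨ cong (_+ length 𝓑) (sym (length-map rotate 𝓐)) ⟩
  length ρ𝓐 + length 𝓑  ≡⟨ sym (length-++ ρ𝓐) ⟩
  length (ρ𝓐 ++ 𝓑)      ≤⟨ unique-⊆⇒length-≤ ρ𝓐++𝓑-unique (⊆-enumeration ρ𝓐++𝓑⊆𝒥 J-enum) ⟩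
  length J              ∎
  where
  open ≤-Reasoning
  ρ𝓐 : List (Subset (suc m))
  ρ𝓐 = map rotate 𝓐
  ρ𝓐++𝓑-unique : Unique (ρ𝓐 ++ 𝓑)
  ρ𝓐++𝓑-unique = Unique.++⁺ (Unique.map⁺ rotate-injective 𝓐-unique) 𝓑-unique
                   (rotated-disjoint (All.map proj₁ 𝓐⊆𝒥) cross)
  ρ𝓐++𝓑⊆𝒥 : All (InJ (suc m) r) (ρ𝓐 ++ 𝓑)
  ρ𝓐++𝓑⊆𝒥 = All.++⁺ (All.map⁺ (All.map (λ {S} → rotate-InJ S) 𝓐⊆𝒥)) 𝓑⊆𝒥
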